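{- In the setting described in the context, let $U\subseteq A$. Then there is $X\subseteq\mathcal{S}$ such that: (1) $N(X,A)\subseteq U$; (2) $w(X)$ equals the total amount of weight that the sets in $U$ receive in Step 1; (3) there is a bijection between $N(U,B_1\cup B_2)$ and $X$ that maps each $v\in B_1\cup B_2$ either to $v$ itself or to a two-element subset of $v$.
   Context: Setting: $\mathcal{S}$ is an instance of the hereditary $3$-set packing problem, i.e., a finite family of nonempty sets of cardinality at most $3$ such that every nonempty subset of a member is a member; $w(s)=|s|-1$, $w(X)=\sum_{s\in X}w(s)$. A feasible solution is a subfamily of pairwise disjoint sets. $N(U,W)=\{x\in W:\exists u\in U:u\cap x\ne\emptyset\}$ and $N(u,W)=N(\{u\},W)$. A family $X\subseteq\mathcal{S}$ of pairwise disjoint sets is a local improvement of a feasible solution $A$ of size $|X|$ if $w(X)>w(N(X,A))$, or $w(X)=w(N(X,A))$ and $X$ contains more sets of weight $2$ than $N(X,A)$. $A$ is a feasible solution with no local improvement of size at most $10$ and $B$ is an optimum (maximum weight) feasible solution; sets of cardinality $1$ are ignored, i.e., $A$ and $B$ consist of sets of cardinality $2$ or $3$. The conflict graph $G$ is the bipartite multigraph with vertex set $A\dot\cup B$ having, for each $(a,b)\in A\times B$, exactly $|a\cap b|$ parallel edges between $a$ and $b$; neighbors, degrees and incident edges refer to $G$. $B_1$ is the set of $v\in B$ with exactly one neighbor in $A$; $B_2$ is the set of $v\in B$ with $w(v)=2$ having exactly two incident edges whose endpoints in $A$ are distinct. Step 1 of the weight distribution: each $v\in B_1$ sends its whole weight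 $w(v)$ to its unique neighbor in $A$, and each $v\in B_2$ sends $1$ along each of its two edges. -}

module Defs where

open import Data.Nat using (ℕ; _≤_; _<_; _∸_; _≟_; _+_)
open import Data.Bool using (if_then_else_)
open import Data.Product using (_×_; Σ-syntax; ∃-syntax)
open import Data.Sum using (_⊎_)
open import Data.List using (List; length; map; filter)
open import Data.Nat.ListAction using (sum)
open import Data.List.Membership.Propositional using () renaming (_∈_ to _∈ᴸ_)
open import Data.List.Relation.Unary.All using (All)
open import Data.List.Relation.Unary.Any using (any?)
open import Data.List.Relation.Unary.Unique.Propositional using (Unique)
open import Data.List.Relation.Unary.AllPairs using (AllPairs)
open import Data.Fin.Subset using (Subset; _∩_; ∣_∣; Nonempty; Empty; _⊆_)
open import Data.Fin.Subset.Properties using (nonempty?)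
open import Relation.Nullary using (¬_; Dec)
open import Relation.Nullary.Decidable using (⌊_⌋; _×-dec_; _⊎-dec_)
open import Relation.Binary.PropositionalEquality using (_≡_)

-- Ground set: Fin n.  A "set" is a subset of Fin n; a family of sets is a
-- duplicate-free list of subsets.

variable n : ℕ

w : Subset n → ℕ
w s = ∣ s ∣ ∸ 1

wt : List (Subset n) → ℕ
wt X = sum (map w X)

count2 : List (Subset n) → ℕ
count2 X = length (filter (λ s → ∣ s ∣ ≟ 3) X)

Meets : Subset n → Subset n → Set
Meets s t = Nonempty (s ∩ t)

meets? : (s t : Subset n) → Dec (Meets s t)
meets? s t = nonempty? (s ∩ t)

Disjoint : Subset n → Subset n → Set
Disjoint s t = Empty (s ∩ t)

Nb : List (Subset n) → List (Subset n) → List (Subset n)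
Nb U W = filter (λ x → any? (λ u → meets? u x) U) W

Hereditary3 : List (Subset n) → Set
Hereditary3 𝒮 =
  Unique 𝒮 ×
  All (λ s → Nonempty s × ∣ s ∣ ≤ 3) 𝒮 ×
  (∀ s t → s ∈ᴸ 𝒮 → t ⊆ s → Nonempty t → t ∈ᴸ 𝒮)

Feasible : List (Subset n) → List (Subset n) → Set
Feasible 𝒮 X = Unique X × All (_∈ᴸ 𝒮) X × AllPairs Disjoint X

LocalImprovement : List (Subset n) → List (Subset n) → List (Subset n) → Set
LocalImprovement 𝒮 A X =
  Feasible 𝒮 X ×
  (wt (Nb X A) < wt X ⊎ (wt X ≡ wt (Nb X A) × count2 (Nb X A) < count2 X))

NoLocalImprovement : ℕ → List (Subset n) → List (Subset n) → Set
NoLocalImprovement k 𝒮 A =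
  ∀ X → length X ≤ k → ¬ LocalImprovement 𝒮 A X

Optimum : List (Subset n) → List (Subset n) → Set
Optimum 𝒮 B = Feasible 𝒮 B × (∀ Y → Feasible 𝒮 Y → wt Y ≤ wt B)

Sizes23 : List (Subset n) → Set
Sizes23 X = All (λ s → ∣ s ∣ ≡ 2 ⊎ ∣ s ∣ ≡ 3) X

-- conflict graph G: between a ∈ A and v ∈ B there are |a ∩ v| parallel edges
-- number of neighbours of v in A
nbrs : List (Subset n) → Subset n → ℕ
nbrs A v = length (filter (λ a → meets? a v) A)

deg : List (Subset n) → Subset n → ℕ
deg A v = sum (map (λ a → ∣ a ∩ v ∣) A)

isB1? : (A : List (Subset n)) (v : Subset n) → Dec (nbrs A v ≡ 1)
isB1? A v = nbrs A v ≟ 1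

-- w(v) = 2 and v has exactly two incident edges, with distinct endpoints in A
-- (i.e. degree 2 and two distinct neighbours)
isB2? : (A : List (Subset n)) (v : Subset n) →
        Dec (∣ v ∣ ≡ 3 × (deg A v ≡ 2 × nbrs A v ≡ 2))
isB2? A v = (∣ v ∣ ≟ 3) ×-dec ((deg A v ≟ 2) ×-dec (nbrs A v ≟ 2))

InB1 : List (Subset n) → List (Subset n) → Subset n → Set
InB1 A B v = v ∈ᴸ B × nbrs A v ≡ 1

InB2 : List (Subset n) → List (Subset n) → Subset n → Set
InB2 A B v = v ∈ᴸ B × (∣ v ∣ ≡ 3 × (deg A v ≡ 2 × nbrs A v ≡ 2))

B12 : List (Subset n) → List (Subset n) → List (Subset n)
B12 A B = filter (λ v → isB1? A v ⊎-dec isB2? A v) B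

-- Step 1: weight received by a ∈ A.
-- each v ∈ B₁ sends w(v) to its unique neighbour; each v ∈ B₂ sends 1 along
-- each of its two edges (so a receives |a ∩ v| from v ∈ B₂).
received : List (Subset n) → List (Subset n) → Subset n → ℕ
received A B a = sum (map (λ v →
    (if ⌊ isB1? A v ⌋ then (if ⌊ meets? a v ⌋ then w v else 0) else 0)
  + (if ⌊ isB2? A v ⌋ then ∣ a ∩ v ∣ else 0)) B)

receivedTotal : List (Subset n) → List (Subset n) → List (Subset n) → ℕ
receivedTotal A B U = sum (map (received A B) U)

-- Let R be the sets of A outside U and send each v ∈ N(U, B₁ ∪ B₂) to v ∖ ⋃R, the part of v
-- not covered by R.  A set v ∈ B₁ meeting U has its only A-neighbour in U, so it stays whole
-- and sends all of w(v) to U.  A set v ∈ B₂ has three elements and two edges, d of them into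
-- U; cutting away the 2 - d elements covered by R leaves 1 + d elements, i.e. weight d, which
-- is what v sends to U.  Disjointness of B makes v ↦ v ∖ ⋃R injective, and v ∖ ⋃R meets no
-- set of R, so N(X, A) ⊆ U.

module Submission where

open import Defs
open import Level using (Level)
open import Function using (_∘_)
open import Data.Nat using (ℕ; zero; suc; _+_; _*_; _∸_; _≤_; _<_; z≤n; s≤s)
open import Data.Nat.Properties
  using ( +-identityʳ; +-comm; +-commutativeSemigroup; +-suc; +-cancelʳ-≡; *-zeroʳ; *-suc; *-identityʳ
        ; m≤m+n; m≤n+m; ≤-trans; <-≤-trans; n≮0)
open import Algebra.Properties.CommutativeSemigroup +-commutativeSemigroup
  using () renaming (interchange to +-interchange)
open import Data.Nat.ListAction using (sum)
open import Data.Nat.ListAction.Properties using (sum-++; sum-↭)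
open import Data.Bool using (if_then_else_)
open import Data.Bool.Properties using (if-eta; if-cong-then)
open import Data.Product using (_×_; _,_; proj₁; proj₂; Σ-syntax; ∃-syntax)
open import Data.Sum using (_⊎_; inj₁; inj₂)
import Data.Sum as Sum
open import Data.Vec using (_∷_; [])
import Data.Vec.Base as Vec
open import Data.Fin using (Fin)
import Data.Fin as Fin
open import Data.Fin.Subset
  using (Subset; _∩_; _∪_; _─_; ⋃; ∣_∣; Nonempty; Empty; _⊆_; _∈_; _∉_; inside; outside)
open import Data.Fin.Subset.Properties
  using ( x∈p∩q⁺; x∈p∩q⁻; x∈p∪q⁺; x∈p∪q⁻; p─q⊆p; p∩q⊆p; ∩-comm; ∩-zeroˡ; ∩-distribʳ-∪; ∉⊥
        ; drop-∷-Empty; Empty-unique; ∣⊥∣≡0)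
open import Data.List using (List; []; _∷_; _++_; [_]; map; filter; length)
open import Data.List.Properties
  using (map-++; map-∘; map-cong; map-cong-local; filter-++; length-++; filter-some; ++-assoc)
open import Data.List.Membership.Propositional using (find) renaming (_∈_ to _∈ᴸ_)
open import Data.List.Membership.Propositional.Properties using (∈-++⁻; ∈-∃++; ∈-map⁺; ∈-map⁻; ∈-filter⁻)
open import Data.List.Relation.Unary.All using (All; []; _∷_)
import Data.List.Relation.Unary.All as All
import Data.List.Relation.Unary.All.Properties as All
open import Data.List.Relation.Unary.Any using (Any; here; there)
import Data.List.Relation.Unary.Any as Any
import Data.List.Relation.Unary.Any.Properties as Any
open import Data.List.Relation.Unary.AllPairs using (AllPairs; []; _∷_)
import Data.List.Relation.Unary.AllPairs as AllPairs
open import Data.List.Relation.Unary.Unique.Propositional using (Unique)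
import Data.List.Relation.Unary.Unique.Propositional.Properties as Unique
open import Data.List.Relation.Binary.Permutation.Propositional
  using (_↭_; ↭-refl; ↭-trans; ↭-reflexive; ↭⇒↭ₛ)
open import Data.List.Relation.Binary.Permutation.Propositional.Properties
  using (∈-resp-↭; shift; filter-↭; ↭-length)
import Data.List.Relation.Binary.Permutation.Propositional.Properties as ↭
import Data.List.Relation.Binary.Permutation.Setoid.Properties as ↭ₛ
open import Relation.Nullary using (¬_; Dec; yes; no; contradiction)
open import Relation.Nullary.Decidable using (⌊_⌋)
open import Relation.Unary using (Pred; Decidable)
open import Relation.Binary using (Rel; Symmetric)
open import Relation.Binary.PropositionalEquality
  using (_≡_; refl; sym; trans; cong; cong₂; subst; resp₂; setoid; module ≡-Reasoning)

private variable
  ℓ ℓ′ : Level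
  X Y : Set ℓ

open ≡-Reasoning

sum-map-0 : (xs : List X) → sum (map (λ _ → 0) xs) ≡ 0
sum-map-0 []       = refl
sum-map-0 (_ ∷ xs) = sum-map-0 xs

sum-map-+ : (f g : X → ℕ) (xs : List X) →
            sum (map (λ x → f x + g x) xs) ≡ sum (map f xs) + sum (map g xs)
sum-map-+ f g []       = refl
sum-map-+ f g (x ∷ xs) = begin
  (f x + g x) + sum (map (λ x → f x + g x) xs)    ≡⟨ cong (f x + g x +_) (sum-map-+ f g xs) ⟩
  (f x + g x) + (sum (map f xs) + sum (map g xs)) ≡⟨ +-interchange (f x) (g x) _ _ ⟩
  (f x + sum (map f xs)) + (g x + sum (map g xs)) ∎

sum-map-swap : (c : X → Y → ℕ) (xs : List X) (ys : List Y) →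
               sum (map (λ x → sum (map (c x) ys)) xs) ≡
               sum (map (λ y → sum (map (λ x → c x y) xs)) ys)
sum-map-swap c []       ys = sym (sum-map-0 ys)
sum-map-swap c (x ∷ xs) ys = begin
  sum (map (c x) ys) + sum (map (λ x → sum (map (c x) ys)) xs)
    ≡⟨ cong (sum (map (c x) ys) +_) (sum-map-swap c xs ys) ⟩
  sum (map (c x) ys) + sum (map (λ y → sum (map (λ x → c x y) xs)) ys)
    ≡⟨ sum-map-+ (c x) _ ys ⟨
  sum (map (λ y → c x y + sum (map (λ x → c x y) xs)) ys)
    ∎

sum-map-filter : {P : Pred X ℓ′} (P? : Decidable P) (f : X → ℕ) →
                 (∀ x → ¬ P x → f x ≡ 0) →
                 (xs : List X) → sum (map f (filter P? xs)) ≡ sum (map f xs)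
sum-map-filter P? f f≡0 []       = refl
sum-map-filter P? f f≡0 (x ∷ xs) with P? x
... | yes _  = cong (f x +_) (sum-map-filter P? f f≡0 xs)
... | no ¬Px = trans (sum-map-filter P? f f≡0 xs) (cong (_+ sum (map f xs)) (sym (f≡0 x ¬Px)))

sum-map-if : {P : Pred X ℓ′} (P? : Decidable P) (k : ℕ) (xs : List X) →
             sum (map (λ x → if ⌊ P? x ⌋ then k else 0) xs) ≡ k * length (filter P? xs)
sum-map-if P? k []       = sym (*-zeroʳ k)
sum-map-if P? k (x ∷ xs) with P? x
... | yes _ = trans (cong (k +_) (sum-map-if P? k xs)) (sym (*-suc k _))
... | no _  = sum-map-if P? k xs

∈⇒≤sum-map : (f : X → ℕ) {x : X} {xs : List X} → x ∈ᴸ xs → f x ≤ sum (map f xs)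
∈⇒≤sum-map f (here refl)             = m≤m+n _ _
∈⇒≤sum-map f {xs = y ∷ _} (there x∈) = ≤-trans (∈⇒≤sum-map f x∈) (m≤n+m _ (f y))

if-dec-true : {P : Set ℓ′} (P? : Dec P) {x y : X} → P → (if ⌊ P? ⌋ then x else y) ≡ x
if-dec-true (yes _) _  = refl
if-dec-true (no ¬p) p = contradiction p ¬p

if-dec-false : {P : Set ℓ′} (P? : Dec P) {x y : X} → ¬ P → (if ⌊ P? ⌋ then x else y) ≡ y
if-dec-false (yes p) ¬p = contradiction p ¬p
if-dec-false (no _)  _  = refl

positive+≡1 : {m k : ℕ} → 0 < m → m + k ≡ 1 → m ≡ 1 × k ≡ 0
positive+≡1 {suc zero}    {zero}  _ _  = refl , refl
positive+≡1 {suc zero}    {suc _} _ ()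
positive+≡1 {suc (suc _)} {_}     _ ()

positive+≡2 : {m k : ℕ} → 0 < m → m + k ≡ 2 → k ≡ 0 ⊎ m ≡ 1
positive+≡2 {suc zero}          {_}     _ _  = inj₂ refl
positive+≡2 {suc (suc zero)}    {zero}  _ _  = inj₁ refl
positive+≡2 {suc (suc zero)}    {suc _} _ ()
positive+≡2 {suc (suc (suc _))} {_}     _ ()

AllPairs-++⁻ʳ : {R : Rel X ℓ′} (xs : List X) {ys : List X} →
                AllPairs R (xs ++ ys) → AllPairs R ys
AllPairs-++⁻ʳ []       pairs = pairs
AllPairs-++⁻ʳ (_ ∷ xs) pairs = AllPairs-++⁻ʳ xs (AllPairs.tail pairs)

AllPairs⇒≡⊎ : {R : Rel X ℓ′} → Symmetric R → {xs : List X} → AllPairs R xs →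
              {x y : X} → x ∈ᴸ xs → y ∈ᴸ xs → x ≡ y ⊎ R x y
AllPairs⇒≡⊎ R-sym (_ ∷ _)     (here refl) (here refl) = inj₁ refl
AllPairs⇒≡⊎ R-sym (Rx ∷ _)    (here refl) (there y∈)  = inj₂ (All.lookup Rx y∈)
AllPairs⇒≡⊎ R-sym (Ry ∷ _)    (there x∈)  (here refl) = inj₂ (R-sym (All.lookup Ry x∈))
AllPairs⇒≡⊎ R-sym (_ ∷ pairs) (there x∈)  (there y∈)  = AllPairs⇒≡⊎ R-sym pairs x∈ y∈

Unique-map⁺ : (f : X → Y) {xs : List X} →
              (∀ {x y} → x ∈ᴸ xs → y ∈ᴸ xs → f x ≡ f y → x ≡ y) →
              Unique xs → Unique (map f xs)
Unique-map⁺ f injective []            = []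
Unique-map⁺ f injective (x∉ ∷ unique) =
  All.map⁺ (All.tabulate λ y∈ fx≡fy → All.lookup x∉ y∈ (injective (here refl) (there y∈) fx≡fy))
  ∷ Unique-map⁺ f (λ x∈ y∈ → injective (there x∈) (there y∈)) unique

↭-complement : {xs ys : List X} → Unique ys → All (_∈ᴸ xs) ys → ∃[ zs ] xs ↭ ys ++ zs
↭-complement {xs = xs} [] [] = xs , ↭-refl
↭-complement {ys = y ∷ ys} (y∉ys ∷ unique) (y∈xs ∷ ys⊆xs)
  with zs , xs↭ ← ↭-complement unique ys⊆xs
  with ∈-++⁻ ys (∈-resp-↭ xs↭ y∈xs)
... | inj₁ y∈ys = contradiction refl (All.lookup y∉ys y∈ys)
... | inj₂ y∈zs with us , vs , refl ← ∈-∃++ y∈zs = us ++ vs , ↭-trans xs↭ move-y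
  where
  move-y : ys ++ (us ++ [ y ] ++ vs) ↭ y ∷ ys ++ (us ++ vs)
  move-y = ↭-trans (↭-reflexive (sym (++-assoc ys us _)))
             (↭-trans (shift y (ys ++ us) vs) (↭-reflexive (cong (y ∷_) (++-assoc ys us vs))))

module _ {xs ys zs : List X} (xs↭ : xs ↭ ys ++ zs) where

  sum-map-↭-++ : (f : X → ℕ) → sum (map f xs) ≡ sum (map f ys) + sum (map f zs)
  sum-map-↭-++ f = begin
    sum (map f xs)                  ≡⟨ sum-↭ (↭.map⁺ f xs↭) ⟩
    sum (map f (ys ++ zs))          ≡⟨ cong sum (map-++ f ys zs) ⟩
    sum (map f ys ++ map f zs)      ≡⟨ sum-++ (map f ys) (map f zs) ⟩
    sum (map f ys) + sum (map f zs) ∎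

  length-filter-↭-++ : {P : Pred X ℓ′} (P? : Decidable P) →
                       length (filter P? xs) ≡ length (filter P? ys) + length (filter P? zs)
  length-filter-↭-++ P? = begin
    length (filter P? xs)                         ≡⟨ ↭-length (filter-↭ P? xs↭) ⟩
    length (filter P? (ys ++ zs))                 ≡⟨ cong length (filter-++ P? ys zs) ⟩
    length (filter P? ys ++ filter P? zs)         ≡⟨ length-++ (filter P? ys) ⟩
    length (filter P? ys) + length (filter P? zs) ∎

  ∈-↭-++⁻ : {x : X} → x ∈ᴸ xs → x ∈ᴸ ys ⊎ x ∈ᴸ zs
  ∈-↭-++⁻ x∈ = ∈-++⁻ ys (∈-resp-↭ xs↭ x∈)

  AllPairs-↭-++⁻ʳ : {R : Rel X ℓ′} → Symmetric R → AllPairs R xs → AllPairs R zs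
  AllPairs-↭-++⁻ʳ {R = R} R-sym pairs =
    AllPairs-++⁻ʳ ys (↭ₛ.AllPairs-resp-↭ (setoid _) R-sym (resp₂ R) (↭⇒↭ₛ xs↭) pairs)

Disjoint-sym : {p q : Subset n} → Disjoint p q → Disjoint q p
Disjoint-sym {p = p} {q} = subst Empty (∩-comm p q)

Disjoint-⊆ : {p p′ q q′ : Subset n} → p′ ⊆ p → q′ ⊆ q → Disjoint p q → Disjoint p′ q′
Disjoint-⊆ {p′ = p′} {q′ = q′} p′⊆p q′⊆q p#q (x , x∈p′∩q′) =
  let x∈p′ , x∈q′ = x∈p∩q⁻ p′ q′ x∈p′∩q′ in p#q (x , x∈p∩q⁺ (p′⊆p x∈p′ , q′⊆q x∈q′))

Nonempty⇒∣p∣>0 : {p : Subset n} → Nonempty p → 0 < ∣ p ∣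
Nonempty⇒∣p∣>0 {p = inside ∷ _}  _                           = s≤s z≤n
Nonempty⇒∣p∣>0 {p = outside ∷ _} (Fin.suc x , Vec.there x∈p) = Nonempty⇒∣p∣>0 (x , x∈p)

∣p∣>0⇒Nonempty : {p : Subset n} → 0 < ∣ p ∣ → Nonempty p
∣p∣>0⇒Nonempty {p = inside ∷ _}  _ = Fin.zero , Vec.here
∣p∣>0⇒Nonempty {p = outside ∷ p} ∣p∣>0
  with x , x∈p ← ∣p∣>0⇒Nonempty {p = p} ∣p∣>0 = Fin.suc x , Vec.there x∈p

Empty⇒∣p∣≡0 : {p : Subset n} → Empty p → ∣ p ∣ ≡ 0
Empty⇒∣p∣≡0 {n = n} p-empty = trans (cong ∣_∣ (Empty-unique p-empty)) (∣⊥∣≡0 n)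

∣p∪q∣≡∣p∣+∣q∣ : {p q : Subset n} → Disjoint p q → ∣ p ∪ q ∣ ≡ ∣ p ∣ + ∣ q ∣
∣p∪q∣≡∣p∣+∣q∣ {p = []}          {[]}          _   = refl
∣p∪q∣≡∣p∣+∣q∣ {p = inside ∷ _}  {inside ∷ _}  p#q = contradiction (Fin.zero , Vec.here) p#q
∣p∪q∣≡∣p∣+∣q∣ {p = inside ∷ _}  {outside ∷ _} p#q =
  cong suc (∣p∪q∣≡∣p∣+∣q∣ (drop-∷-Empty p#q))
∣p∪q∣≡∣p∣+∣q∣ {p = outside ∷ p} {inside ∷ q}  p#q =
  trans (cong suc (∣p∪q∣≡∣p∣+∣q∣ (drop-∷-Empty p#q))) (sym (+-suc ∣ p ∣ ∣ q ∣))
∣p∪q∣≡∣p∣+∣q∣ {p = outside ∷ _} {outside ∷ _} p#q = ∣p∪q∣≡∣p∣+∣q∣ (drop-∷-Empty p#q)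

∣p∣≡∣q∩p∣+∣p─q∣ : (p q : Subset n) → ∣ p ∣ ≡ ∣ q ∩ p ∣ + ∣ p ─ q ∣
∣p∣≡∣q∩p∣+∣p─q∣ []            []            = refl
∣p∣≡∣q∩p∣+∣p─q∣ (inside ∷ p)  (inside ∷ q)  = cong suc (∣p∣≡∣q∩p∣+∣p─q∣ p q)
∣p∣≡∣q∩p∣+∣p─q∣ (inside ∷ p)  (outside ∷ q) =
  trans (cong suc (∣p∣≡∣q∩p∣+∣p─q∣ p q)) (sym (+-suc ∣ q ∩ p ∣ ∣ p ─ q ∣))
∣p∣≡∣q∩p∣+∣p─q∣ (outside ∷ p) (inside ∷ q)  = ∣p∣≡∣q∩p∣+∣p─q∣ p q
∣p∣≡∣q∩p∣+∣p─q∣ (outside ∷ p) (outside ∷ q) = ∣p∣≡∣q∩p∣+∣p─q∣ p q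

p─q≡p : {p q : Subset n} → Disjoint q p → p ─ q ≡ p
p─q≡p {p = []}          {[]}          _   = refl
p─q≡p {p = inside ∷ _}  {inside ∷ _}  q#p = contradiction (Fin.zero , Vec.here) q#p
p─q≡p {p = inside ∷ _}  {outside ∷ _} q#p = cong (inside ∷_) (p─q≡p (drop-∷-Empty q#p))
p─q≡p {p = outside ∷ _} {inside ∷ _}  q#p = cong (outside ∷_) (p─q≡p (drop-∷-Empty q#p))
p─q≡p {p = outside ∷ _} {outside ∷ _} q#p = cong (outside ∷_) (p─q≡p (drop-∷-Empty q#p))

x∈p─q⇒x∉q : {x : Fin n} (p q : Subset n) → x ∈ p ─ q → x ∉ q
x∈p─q⇒x∉q (inside ∷ p) (outside ∷ q) Vec.here          ()
x∈p─q⇒x∉q (_ ∷ p)      (_ ∷ q)       (Vec.there x∈p─q) (Vec.there x∈q) = x∈p─q⇒x∉q p q x∈p─q x∈q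

x∈⋃⁺ : {x : Fin n} {p : Subset n} {ps : List (Subset n)} → x ∈ p → p ∈ᴸ ps → x ∈ ⋃ ps
x∈⋃⁺ x∈p (here refl)  = x∈p∪q⁺ (inj₁ x∈p)
x∈⋃⁺ x∈p (there p∈ps) = x∈p∪q⁺ (inj₂ (x∈⋃⁺ x∈p p∈ps))

⋃-Disjoint : {q : Subset n} {ps : List (Subset n)} →
             All (λ p → Disjoint p q) ps → Disjoint (⋃ ps) q
⋃-Disjoint {q = q} [] (x , x∈⊥∩q) = ∉⊥ (proj₁ (x∈p∩q⁻ _ q x∈⊥∩q))
⋃-Disjoint {q = q} {p ∷ ps} (p#q ∷ ps#q) (x , x∈∩q)
  with x∈∪ , x∈q ← x∈p∩q⁻ (p ∪ ⋃ ps) q x∈∩q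
  with x∈p∪q⁻ p (⋃ ps) x∈∪
... | inj₁ x∈p = p#q (x , x∈p∩q⁺ (x∈p , x∈q))
... | inj₂ x∈⋃ = ⋃-Disjoint ps#q (x , x∈p∩q⁺ (x∈⋃ , x∈q))

p─⋃ps≡p : {p : Subset n} {ps : List (Subset n)} → All (λ q → Disjoint q p) ps → p ─ ⋃ ps ≡ p
p─⋃ps≡p ps#p = p─q≡p (⋃-Disjoint ps#p)

deg≡∣⋃∩∣ : {q : Subset n} {ps : List (Subset n)} → AllPairs Disjoint ps → deg ps q ≡ ∣ ⋃ ps ∩ q ∣
deg≡∣⋃∩∣ {n = n} {q = q} [] = sym (trans (cong ∣_∣ (∩-zeroˡ q)) (∣⊥∣≡0 n))
deg≡∣⋃∩∣ {q = q} {p ∷ ps} (p#ps ∷ pairs) = begin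
  ∣ p ∩ q ∣ + deg ps q     ≡⟨ cong (∣ p ∩ q ∣ +_) (deg≡∣⋃∩∣ pairs) ⟩
  ∣ p ∩ q ∣ + ∣ ⋃ ps ∩ q ∣ ≡⟨ ∣p∪q∣≡∣p∣+∣q∣ p∩q#⋃ps∩q ⟨
  ∣ (p ∩ q) ∪ (⋃ ps ∩ q) ∣ ≡⟨ cong ∣_∣ (∩-distribʳ-∪ q p (⋃ ps)) ⟨
  ∣ (p ∪ ⋃ ps) ∩ q ∣       ∎
  where
  p∩q#⋃ps∩q : Disjoint (p ∩ q) (⋃ ps ∩ q)
  p∩q#⋃ps∩q = Disjoint-⊆ (p∩q⊆p p q) (p∩q⊆p (⋃ ps) q)
                (Disjoint-sym (⋃-Disjoint (All.map Disjoint-sym p#ps)))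

∣p─⋃ps∣+deg≡∣p∣ : {p : Subset n} {ps : List (Subset n)} → AllPairs Disjoint ps →
                  ∣ p ─ ⋃ ps ∣ + deg ps p ≡ ∣ p ∣
∣p─⋃ps∣+deg≡∣p∣ {p = p} {ps} pairs = begin
  ∣ p ─ ⋃ ps ∣ + deg ps p     ≡⟨ cong (∣ p ─ ⋃ ps ∣ +_) (deg≡∣⋃∩∣ pairs) ⟩
  ∣ p ─ ⋃ ps ∣ + ∣ ⋃ ps ∩ p ∣ ≡⟨ +-comm ∣ p ─ ⋃ ps ∣ _ ⟩
  ∣ ⋃ ps ∩ p ∣ + ∣ p ─ ⋃ ps ∣ ≡⟨ ∣p∣≡∣q∩p∣+∣p─q∣ p (⋃ ps) ⟨
  ∣ p ∣                       ∎

nbrs≡0⇒Disjoint : {q : Subset n} (ps : List (Subset n)) →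
                  nbrs ps q ≡ 0 → All (λ p → Disjoint p q) ps
nbrs≡0⇒Disjoint {q = q} ps nbrs≡0 = All.tabulate λ p∈ps p∼q →
  n≮0 (subst (0 <_) nbrs≡0 (filter-some (λ a → meets? a q) (Any.map (λ { refl → p∼q }) p∈ps)))

deg≡0⇒Disjoint : {q : Subset n} (ps : List (Subset n)) →
                 deg ps q ≡ 0 → All (λ p → Disjoint p q) ps
deg≡0⇒Disjoint {q = q} ps deg≡0 = All.tabulate λ {p} p∈ps p∼q →
  n≮0 (<-≤-trans (Nonempty⇒∣p∣>0 p∼q) (subst (∣ p ∩ q ∣ ≤_) deg≡0 (∈⇒≤sum-map _ p∈ps)))

IsB1 IsB2 : List (Subset n) → Subset n → Set
IsB1 A v = nbrs A v ≡ 1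
IsB2 A v = ∣ v ∣ ≡ 3 × (deg A v ≡ 2 × nbrs A v ≡ 2)

SelfOrPairOf : Subset n → Subset n → Set
SelfOrPairOf s v = s ≡ v ⊎ (s ⊆ v × ∣ s ∣ ≡ 2)

-- `received A B a` unfolds to `sum (map (λ v → sends A v a) B)`.
sends : List (Subset n) → Subset n → Subset n → ℕ
sends A v a = (if ⌊ isB1? A v ⌋ then (if ⌊ meets? a v ⌋ then w v else 0) else 0)
            + (if ⌊ isB2? A v ⌋ then ∣ a ∩ v ∣ else 0)

sentTo : List (Subset n) → List (Subset n) → Subset n → ℕ
sentTo A U v = sum (map (sends A v) U)

module _ {A : List (Subset n)} {v : Subset n} where

  B1⇒¬B2 : IsB1 A v → ¬ IsB2 A v
  B1⇒¬B2 one (_ , _ , two) = contradiction (trans (sym one) two) λ ()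

  sentTo-B1 : {U : List (Subset n)} → IsB1 A v → sentTo A U v ≡ w v * nbrs U v
  sentTo-B1 {U} one = begin
    sentTo A U v                                          ≡⟨ cong sum (map-cong sends-B1 U) ⟩
    sum (map (λ a → if ⌊ meets? a v ⌋ then w v else 0) U) ≡⟨ sum-map-if (λ a → meets? a v) (w v) U ⟩
    w v * nbrs U v                                        ∎
    where
    sends-B1 : (a : Subset n) → sends A v a ≡ (if ⌊ meets? a v ⌋ then w v else 0)
    sends-B1 a = trans (cong₂ _+_ (if-dec-true (isB1? A v) one) (if-dec-false (isB2? A v) (B1⇒¬B2 one)))
                       (+-identityʳ _)

  sentTo-B2 : {U : List (Subset n)} → IsB2 A v → sentTo A U v ≡ deg U v
  sentTo-B2 {U} v∈B2 = cong sum (map-cong sends-B2 U)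
    where
    sends-B2 : (a : Subset n) → sends A v a ≡ ∣ a ∩ v ∣
    sends-B2 a = cong₂ _+_ (if-dec-false (isB1? A v) (λ one → B1⇒¬B2 one v∈B2))
                           (if-dec-true (isB2? A v) v∈B2)

  sentTo-∉B12 : {U : List (Subset n)} → ¬ (IsB1 A v ⊎ IsB2 A v) → sentTo A U v ≡ 0
  sentTo-∉B12 {U} v∉B12 = trans (cong sum (map-cong sends-∉B12 U)) (sum-map-0 U)
    where
    sends-∉B12 : (a : Subset n) → sends A v a ≡ 0
    sends-∉B12 a = cong₂ _+_ (if-dec-false (isB1? A v) (v∉B12 ∘ inj₁))
                             (if-dec-false (isB2? A v) (v∉B12 ∘ inj₂))

  sentTo-Disjoint : {U : List (Subset n)} → ¬ Any (λ u → Meets u v) U → sentTo A U v ≡ 0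
  sentTo-Disjoint {U} U#v =
    trans (cong sum (map-cong-local (All.map sends-Disjoint (All.¬Any⇒All¬ U U#v)))) (sum-map-0 U)
    where
    sends-Disjoint : {a : Subset n} → Disjoint a v → sends A v a ≡ 0
    sends-Disjoint {a} a#v = cong₂ _+_
      (trans (if-cong-then ⌊ isB1? A v ⌋ (if-dec-false (meets? a v) a#v)) (if-eta ⌊ isB1? A v ⌋))
      (trans (if-cong-then ⌊ isB2? A v ⌋ (Empty⇒∣p∣≡0 a#v)) (if-eta ⌊ isB2? A v ⌋))

receivedTotal≡sum-sentTo : (A B U : List (Subset n)) →
                           receivedTotal A B U ≡ sum (map (sentTo A U) (Nb U (B12 A B)))
receivedTotal≡sum-sentTo A B U = begin
  receivedTotal A B U
    ≡⟨ sum-map-swap (λ a v → sends A v a) U B ⟩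
  sum (map (sentTo A U) B)
    ≡⟨ sum-map-filter _ (sentTo A U) (λ v → sentTo-∉B12 {A = A} {v} {U}) B ⟨
  sum (map (sentTo A U) (B12 A B))
    ≡⟨ sum-map-filter _ (sentTo A U) (λ v → sentTo-Disjoint {A = A} {v} {U}) (B12 A B) ⟨
  sum (map (sentTo A U) (Nb U (B12 A B)))
    ∎

∈-Nb-B12⁻ : (A B U : List (Subset n)) {v : Subset n} → v ∈ᴸ Nb U (B12 A B) →
            v ∈ᴸ B × (IsB1 A v ⊎ IsB2 A v) × Any (λ u → Meets u v) U
∈-Nb-B12⁻ _ _ _ v∈
  with v∈B12 , U∼v ← ∈-filter⁻ _ v∈
  with v∈B , v∈B1∪B2 ← ∈-filter⁻ _ v∈B12 = v∈B , v∈B1∪B2 , U∼v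

module Shrink {A U R : List (Subset n)} (A↭U++R : A ↭ U ++ R) (A-disjoint : AllPairs Disjoint A) where

  private
    R-disjoint : AllPairs Disjoint R
    R-disjoint = AllPairs-↭-++⁻ʳ {ys = U} A↭U++R Disjoint-sym A-disjoint

  shrink-B1 : {v : Subset n} → IsB1 A v → Any (λ u → Meets u v) U → v ─ ⋃ R ≡ v × nbrs U v ≡ 1
  shrink-B1 {v} one U∼v = p─⋃ps≡p (nbrs≡0⇒Disjoint R (proj₂ nbrsU,R≡1,0)) , proj₁ nbrsU,R≡1,0
    where
    nbrsU,R≡1,0 : nbrs U v ≡ 1 × nbrs R v ≡ 0
    nbrsU,R≡1,0 = positive+≡1 (filter-some (λ a → meets? a v) U∼v)
                    (trans (sym (length-filter-↭-++ {ys = U} A↭U++R (λ a → meets? a v))) one)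

  shrink-B2 : {v : Subset n} → IsB2 A v → Any (λ u → Meets u v) U →
              ∣ v ─ ⋃ R ∣ ≡ suc (deg U v) × (v ─ ⋃ R ≡ v ⊎ ∣ v ─ ⋃ R ∣ ≡ 2)
  shrink-B2 {v} (three , two , _) U∼v = size , shape (positive+≡2 0<degU degU+degR≡2)
    where
    degU+degR≡2 : deg U v + deg R v ≡ 2
    degU+degR≡2 = trans (sym (sum-map-↭-++ {ys = U} A↭U++R (λ a → ∣ a ∩ v ∣))) two
    size : ∣ v ─ ⋃ R ∣ ≡ suc (deg U v)
    size = +-cancelʳ-≡ (deg R v) _ _
             (trans (trans (∣p─⋃ps∣+deg≡∣p∣ R-disjoint) three) (cong suc (sym degU+degR≡2)))
    0<degU : 0 < deg U v
    0<degU with u , u∈U , u∼v ← find U∼v = <-≤-trans (Nonempty⇒∣p∣>0 u∼v) (∈⇒≤sum-map _ u∈U)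
    shape : deg R v ≡ 0 ⊎ deg U v ≡ 1 → v ─ ⋃ R ≡ v ⊎ ∣ v ─ ⋃ R ∣ ≡ 2
    shape (inj₁ degR≡0) = inj₁ (p─⋃ps≡p (deg≡0⇒Disjoint R degR≡0))
    shape (inj₂ degU≡1) = inj₂ (trans size (cong suc degU≡1))

  shrink-spec : {v : Subset n} → Nonempty v → IsB1 A v ⊎ IsB2 A v → Any (λ u → Meets u v) U →
                sentTo A U v ≡ w (v ─ ⋃ R) × SelfOrPairOf (v ─ ⋃ R) v × Nonempty (v ─ ⋃ R)
  shrink-spec {v} v≠∅ (inj₁ one) U∼v with shrunk≡v , nbrsU≡1 ← shrink-B1 one U∼v rewrite shrunk≡v =
    trans (sentTo-B1 {A = A} {v} {U} one) (trans (cong (w v *_) nbrsU≡1) (*-identityʳ (w v))) ,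
    inj₁ refl ,
    v≠∅
  shrink-spec {v} _ (inj₂ v∈B2) U∼v with size , shape ← shrink-B2 v∈B2 U∼v =
    trans (sentTo-B2 {A = A} {v} {U} v∈B2) (cong (_∸ 1) (sym size)) ,
    Sum.map₂ (p─q⊆p v (⋃ R) ,_) shape ,
    ∣p∣>0⇒Nonempty (subst (0 <_) (sym size) (s≤s z≤n))

  Nb-shrink⊆U : (vs : List (Subset n)) {a : Subset n} → a ∈ᴸ Nb (map (_─ ⋃ R) vs) A → a ∈ᴸ U
  Nb-shrink⊆U vs {a} a∈
    with a∈A , vs∼a ← ∈-filter⁻ _ a∈
    with ∈-↭-++⁻ {ys = U} A↭U++R a∈A
  ... | inj₁ a∈U = a∈U
  ... | inj₂ a∈R with v , _ , x , x∈v∩a ← find (Any.map⁻ vs∼a) =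
    contradiction (x∈⋃⁺ (proj₂ (x∈p∩q⁻ _ a x∈v∩a)) a∈R) (x∈p─q⇒x∉q v (⋃ R) (proj₁ (x∈p∩q⁻ _ a x∈v∩a)))

  module Neighbours {B : List (Subset n)} (B-disjoint : AllPairs Disjoint B)
                    (B-nonempty : All Nonempty B) where

    shrink-Nb-B12 : {v : Subset n} → v ∈ᴸ Nb U (B12 A B) →
                    sentTo A U v ≡ w (v ─ ⋃ R) × SelfOrPairOf (v ─ ⋃ R) v × Nonempty (v ─ ⋃ R)
    shrink-Nb-B12 v∈ with v∈B , v∈B1∪B2 , U∼v ← ∈-Nb-B12⁻ A B U v∈ =
      shrink-spec (All.lookup B-nonempty v∈B) v∈B1∪B2 U∼v

    shrink-injective : {v v′ : Subset n} → v ∈ᴸ Nb U (B12 A B) → v′ ∈ᴸ Nb U (B12 A B) →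
                       v ─ ⋃ R ≡ v′ ─ ⋃ R → v ≡ v′
    shrink-injective {v} {v′} v∈ v′∈ same
      with AllPairs⇒≡⊎ Disjoint-sym B-disjoint (proj₁ (∈-Nb-B12⁻ A B U v∈)) (proj₁ (∈-Nb-B12⁻ A B U v′∈))
    ... | inj₁ v≡v′ = v≡v′
    ... | inj₂ v#v′ with x , x∈ ← proj₂ (proj₂ (shrink-Nb-B12 v∈)) =
      contradiction (x , x∈p∩q⁺ (x∈ , subst (x ∈_) same x∈))
                    (Disjoint-⊆ (p─q⊆p v (⋃ R)) (p─q⊆p v′ (⋃ R)) v#v′)

    wt-shrink : wt (map (_─ ⋃ R) (Nb U (B12 A B))) ≡ receivedTotal A B U
    wt-shrink = begin
      sum (map w (map (_─ ⋃ R) (Nb U (B12 A B)))) ≡⟨ cong sum (map-∘ (Nb U (B12 A B))) ⟨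
      sum (map (w ∘ (_─ ⋃ R)) (Nb U (B12 A B)))   ≡⟨ cong sum (map-cong-local sent≡w) ⟨
      sum (map (sentTo A U) (Nb U (B12 A B)))     ≡⟨ receivedTotal≡sum-sentTo A B U ⟨
      receivedTotal A B U                         ∎
      where
      sent≡w : All (λ v → sentTo A U v ≡ w (v ─ ⋃ R)) (Nb U (B12 A B))
      sent≡w = All.tabulate (proj₁ ∘ shrink-Nb-B12)

lemma2 : ∀ {n : ℕ} (𝒮 A B U : List (Subset n)) →
    Hereditary3 𝒮 →
    Feasible 𝒮 A → Sizes23 A → NoLocalImprovement 10 𝒮 A →
    Optimum 𝒮 B → Sizes23 B →
    Unique U → All (_∈ᴸ A) U →
    Σ[ X ∈ List (Subset n) ] Σ[ f ∈ (Subset n → Subset n) ]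
      (Unique X × All (_∈ᴸ 𝒮) X) ×
      (∀ a → a ∈ᴸ Nb X A → a ∈ᴸ U) ×
      (wt X ≡ receivedTotal A B U) ×
      ((∀ v → v ∈ᴸ Nb U (B12 A B) →
          f v ∈ᴸ X × (f v ≡ v ⊎ (f v ⊆ v × ∣ f v ∣ ≡ 2))) ×
       (∀ v v′ → v ∈ᴸ Nb U (B12 A B) → v′ ∈ᴸ Nb U (B12 A B) →
          f v ≡ f v′ → v ≡ v′) ×
       (∀ x → x ∈ᴸ X → ∃[ v ] (v ∈ᴸ Nb U (B12 A B) × f v ≡ x)))
lemma2 {n} 𝒮 A B U (_ , 𝒮-nonempty , hereditary) (_ , _ , A-disjoint) _ _
       ((B-unique , B⊆𝒮 , B-disjoint) , _) _ U-unique U⊆A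
  with R , A↭U++R ← ↭-complement U-unique U⊆A =
  map (_─ ⋃ R) L , (_─ ⋃ R) ,
  (Unique-map⁺ (_─ ⋃ R) shrink-injective L-unique , All.map⁺ (All.tabulate shrunk∈𝒮)) ,
  (λ _ → Nb-shrink⊆U L) ,
  wt-shrink ,
  ((λ _ v∈ → ∈-map⁺ _ v∈ , proj₁ (proj₂ (shrink-Nb-B12 v∈))) ,
   (λ _ _ → shrink-injective) ,
   (λ _ x∈ → let v , v∈ , x≡ = ∈-map⁻ _ x∈ in v , v∈ , sym x≡))
  where
  B-nonempty : All Nonempty B
  B-nonempty = All.map (proj₁ ∘ All.lookup 𝒮-nonempty) B⊆𝒮

  open Shrink {U = U} {R} A↭U++R A-disjoint
  open Neighbours B-disjoint B-nonempty

  L : List (Subset n)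
  L = Nb U (B12 A B)

  L-unique : Unique L
  L-unique = Unique.filter⁺ _ (Unique.filter⁺ _ B-unique)

  shrunk∈𝒮 : {v : Subset n} → v ∈ᴸ L → v ─ ⋃ R ∈ᴸ 𝒮
  shrunk∈𝒮 {v} v∈ = hereditary v _ (All.lookup B⊆𝒮 (proj₁ (∈-Nb-B12⁻ A B U v∈))) (p─q⊆p v (⋃ R))
                                 (proj₂ (proj₂ (shrink-Nb-B12 v∈)))
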